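{- Let $n\geq 2$ and let $m\geq 1$ be the integer with $\lceil\sqrt{n}\,\rceil=m+1$. Then the $n$-book graph satisfies $\chi_D(B_n)<\lceil\sqrt{n}\,\rceil+2$ if and only if $m^2<n\leq m^2+m+1$.
   Context: The $n$-book graph $B_n$ ($n\geq 2$) is the Cartesian product of the star $K_{1,n}$ and the path $P_2$ on two vertices; concretely it has vertices $v_0,w_0,v_1,w_1,\dots,v_n,w_n$ and edges $v_0w_0$, $v_0v_i$, $w_0w_i$, $v_iw_i$ for $1\leq i\leq n$. A vertex coloring is distinguishing if the only automorphism preserving all vertex colors is the identity. The distinguishing chromatic number $\chi_D(G)$ is the minimum $r$ such that $G$ has a proper distinguishing coloring with $r$ colors. -}

module Defs where

open import Data.Nat using (ℕ; suc; _*_; _<_; _≤_)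
open import Data.Bool using (Bool; true; false)
open import Data.Fin using (Fin; zero; suc)
open import Data.Product using (_×_; _,_; Σ; ∃)
open import Data.Sum using (_⊎_)
open import Data.Empty using (⊥)
open import Data.Unit using (⊤)
open import Relation.Binary.PropositionalEquality using (_≡_)
open import Relation.Nullary using (¬_)
open import Function.Bundles using (_↔_; Inverse)

-- Vertices of the n-book graph B_n: (false , i) is v_i, (true , i) is w_i,
-- with i ∈ {0,…,n}; index 0 is the centre.
BookV : ℕ → Set
BookV n = Bool × Fin (suc n)

BookAdj : (n : ℕ) → BookV n → BookV n → Set
BookAdj n (false , i) (true , j) = i ≡ j
BookAdj n (true , i) (false , j) = i ≡ j
BookAdj n (false , zero) (false , suc _) = ⊤
BookAdj n (false , suc _) (false , zero) = ⊤
BookAdj n (true , zero) (true , suc _) = ⊤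
BookAdj n (true , suc _) (true , zero) = ⊤
BookAdj n (_ , _) (_ , _) = ⊥

record BookAut (n : ℕ) : Set where
  field
    perm : BookV n ↔ BookV n
    preserves : ∀ x y →
      (BookAdj n x y → BookAdj n (Inverse.to perm x) (Inverse.to perm y)) ×
      (BookAdj n (Inverse.to perm x) (Inverse.to perm y) → BookAdj n x y)

Coloring : ℕ → ℕ → Set
Coloring n r = BookV n → Fin r

Proper : (n r : ℕ) → Coloring n r → Set
Proper n r c = ∀ x y → BookAdj n x y → ¬ (c x ≡ c y)

Distinguishing : (n r : ℕ) → Coloring n r → Set
Distinguishing n r c = ∀ (σ : BookAut n) →
  (∀ x → c (Inverse.to (BookAut.perm σ) x) ≡ c x) →
  ∀ x → Inverse.to (BookAut.perm σ) x ≡ x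

HasDistCol : ℕ → ℕ → Set
HasDistCol n r = Σ (Coloring n r) λ c → Proper n r c × Distinguishing n r c

-- χ_D(B_n) < k  ⟺  there is some r < k with a proper distinguishing r-coloring
-- (χ_D is the minimum such r).
ChiDLess : ℕ → ℕ → Set
ChiDLess n k = ∃ λ r → r < k × HasDistCol n r

CeilSqrtIs : ℕ → ℕ → Set
CeilSqrtIs n (suc m) = m * m < n × n ≤ suc m * suc m
CeilSqrtIs n 0 = n ≡ 0

-- A proper colouring of B_n gives the spine v₀w₀ two colours a ≠ b and every
-- page (vᵢ , wᵢ) an ordered pair (x , y) with x ≠ a, y ≠ b and x ≠ y. With
-- k + 2 colours there are exactly (k + 1) + k² such pairs: either x = b and
-- y ≠ b, or x ∉ {a , b} and y ∉ {b , x}. For n ≥ 2 the spine vertices are the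
-- only vertices of degree at least 3, so every automorphism permutes the pages,
-- and a proper colouring is distinguishing iff distinct pages get distinct
-- pairs: two pages with the same pair are exchanged by a colour-preserving
-- automorphism. Hence χ_D(B_n) ≤ k + 2 iff n ≤ k² + k + 1.
module Submission where

open import Defs
open import Data.Nat using (ℕ; suc; _+_; _*_; _<_; _≤_)
open import Data.Product using (_×_)
open import Function.Bundles using (_⇔_)

open import Data.Bool using (true; false; not)
open import Data.Empty using (⊥; ⊥-elim)
open import Data.Fin using (Fin; zero; suc; punchIn; punchOut; inject≤; lift)
open import Data.Fin.Patterns using (0F; 1F)
open import Data.Fin.Permutation using (Permutation′; transpose; _⟨$⟩ʳ_; _⟨$⟩ˡ_; inverseˡ; inverseʳ)
open import Data.Fin.Properties
  using (_≟_; ¬Fin0; suc-injective; punchOut-cong; punchOut-injective; punchIn-injective; punchInᵢ≢i;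
         inject≤-injective; injective⇒≤; +↔⊎; *↔×)
open import Data.Nat using (s≤s)
open import Data.Nat.Properties using (≤-trans; ≤-reflexive; ≤-pred; +-comm; +-mono-≤; *-mono-≤)
open import Data.Nat.Tactic.RingSolver using (solve-∀)
open import Data.Product using (_,_; proj₁; proj₂; ∃; map₂)
open import Data.Sum using (_⊎_; inj₁; inj₂; [_,_]′)
open import Data.Sum.Function.Propositional using (_⊎-↔_)
open import Data.Sum.Properties using (inj₁-injective; inj₂-injective)
open import Data.Unit using (tt)
open import Function.Base using (_∘_; id)
open import Function.Bundles using (Inverse; Injection; _↔_; mk↔ₛ′; mk⇔)
open import Function.Construct.Composition using (_↔-∘_)
open import Function.Construct.Identity using (↔-id)
open import Function.Construct.Symmetry using (↔-sym)
open import Function.Definitions using (Injective)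
open import Function.Properties.Inverse using (↔⇒↣)
open import Relation.Binary.PropositionalEquality using (_≡_; _≢_; refl; sym; trans; cong; cong₂; subst₂)
open import Relation.Nullary using (yes; no; contradiction)

private
  variable
    k n r : ℕ

transpose-moves : (i j : Fin n) → transpose i j ⟨$⟩ʳ i ≡ j
transpose-moves i j with i ≟ i
... | yes _   = refl
... | no i≢i = contradiction refl i≢i

transpose-invariant : {A : Set} (f : Fin n → A) {i j : Fin n} →
                      f i ≡ f j → ∀ l → f (transpose i j ⟨$⟩ʳ l) ≡ f l
transpose-invariant f {i} {j} fi≡fj l with l ≟ i
... | yes refl = sym fi≡fj
... | no _ with l ≟ j
...   | yes refl = fi≡fj
...   | no _     = refl

punchOut-injective′ : {i i′ j l : Fin (suc n)} → i ≡ i′ →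
                      (i≢j : i ≢ j) (i′≢l : i′ ≢ l) → punchOut i≢j ≡ punchOut i′≢l → j ≡ l
punchOut-injective′ refl = punchOut-injective

punchOut₂ : {i j x : Fin (suc (suc k))} → i ≢ j → i ≢ x → j ≢ x → Fin k
punchOut₂ i≢j i≢x j≢x = punchOut (j≢x ∘ punchOut-injective i≢j i≢x)

punchOut₂-injective : {i j x y : Fin (suc (suc k))}
                      {i≢j i≢j′ : i ≢ j} {i≢x : i ≢ x} {i≢y : i ≢ y}
                      (j≢x : j ≢ x) (j≢y : j ≢ y) →
                      punchOut₂ i≢j i≢x j≢x ≡ punchOut₂ i≢j′ i≢y j≢y → x ≡ y
punchOut₂-injective {i = i} {i≢x = i≢x} {i≢y} _ _ e =
  punchOut-injective i≢x i≢y (punchOut-injective′ (punchOut-cong i refl) _ _ e)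

no-three-distinct-in-pair : {A : Set} {u v x y z : A} → x ≢ y → x ≢ z → y ≢ z →
                            x ≡ u ⊎ x ≡ v → y ≡ u ⊎ y ≡ v → z ≡ u ⊎ z ≡ v → ⊥
no-three-distinct-in-pair x≢y _ _ (inj₁ refl) (inj₁ refl) _ = x≢y refl
no-three-distinct-in-pair x≢y _ _ (inj₂ refl) (inj₂ refl) _ = x≢y refl
no-three-distinct-in-pair _ x≢z _ (inj₁ refl) _ (inj₁ refl) = x≢z refl
no-three-distinct-in-pair _ x≢z _ (inj₂ refl) _ (inj₂ refl) = x≢z refl
no-three-distinct-in-pair _ _ y≢z _ (inj₁ refl) (inj₁ refl) = y≢z refl
no-three-distinct-in-pair _ _ y≢z _ (inj₂ refl) (inj₂ refl) = y≢z refl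

Admissible : Fin r → Fin r → Fin r × Fin r → Set
Admissible a b (x , y) = x ≢ a × y ≢ b × x ≢ y

PairCode : ℕ → Set
PairCode k = Fin (suc k) ⊎ (Fin k × Fin k)

Fin↔PairCode : Fin (suc k + k * k) ↔ PairCode k
Fin↔PairCode = (↔-id _ ⊎-↔ *↔×) ↔-∘ +↔⊎

module _ {a b : Fin (suc (suc k))} (a≢b : a ≢ b) where

  encodeAdmissible : ∀ p → Admissible a b p → PairCode k
  encodeAdmissible (x , y) (x≢a , y≢b , x≢y) with x ≟ b
  ... | yes _   = inj₁ (punchOut (y≢b ∘ sym))
  ... | no x≢b  = inj₂ (punchOut₂ a≢b (x≢a ∘ sym) (x≢b ∘ sym) ,
                        punchOut₂ x≢b x≢y (y≢b ∘ sym))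

  encodeAdmissible-injective : ∀ {p q} (p-adm : Admissible a b p) (q-adm : Admissible a b q) →
                               encodeAdmissible p p-adm ≡ encodeAdmissible q q-adm → p ≡ q
  encodeAdmissible-injective {x , y} {x′ , y′} (_ , y≢b , _) (_ , y′≢b , _) e with x ≟ b | x′ ≟ b
  ... | yes refl | yes refl = cong (b ,_) (punchOut-injective {i = b} _ _ (inj₁-injective e))
  ... | no x≢b   | no x′≢b
    with refl ← punchOut₂-injective {i = a} (x≢b ∘ sym) (x′≢b ∘ sym) (cong proj₁ (inj₂-injective e))
    = cong (x ,_) (punchOut₂-injective {i = x} (y≢b ∘ sym) (y′≢b ∘ sym) (cong proj₂ (inj₂-injective e)))
  encodeAdmissible-injective _ _ () | yes _ | no _
  encodeAdmissible-injective _ _ () | no _  | yes _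

  injective-admissible⇒≤ : (f : Fin n → Fin (suc (suc k)) × Fin (suc (suc k))) →
                           (∀ i → Admissible a b (f i)) → Injective _≡_ _≡_ f → n ≤ suc k + k * k
  injective-admissible⇒≤ f adm f-injective =
    injective⇒≤ {f = Inverse.from Fin↔PairCode ∘ λ i → encodeAdmissible (f i) (adm i)}
      (f-injective ∘ encodeAdmissible-injective (adm _) (adm _) ∘
       Injection.injective (↔⇒↣ (↔-sym Fin↔PairCode)))

decodeAdmissible : PairCode k → Fin (suc (suc k)) × Fin (suc (suc k))
decodeAdmissible (inj₁ t)       = 1F , punchIn 1F t
decodeAdmissible (inj₂ (p , q)) = suc (suc p) , punchIn 1F (punchIn (suc p) q)

decodeAdmissible-admissible : ∀ t → Admissible 0F 1F (decodeAdmissible {k} t)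
decodeAdmissible-admissible (inj₁ t)       = (λ ()) , punchInᵢ≢i 1F t , punchInᵢ≢i 1F t ∘ sym
decodeAdmissible-admissible (inj₂ (p , q)) =
  (λ ()) , punchInᵢ≢i 1F _ , punchInᵢ≢i (suc p) q ∘ sym ∘ punchIn-injective 1F (suc p) _

decodeAdmissible-injective : Injective _≡_ _≡_ (decodeAdmissible {k})
decodeAdmissible-injective {x = inj₁ t} {inj₁ t′} e = cong inj₁ (punchIn-injective 1F t t′ (cong proj₂ e))
decodeAdmissible-injective {x = inj₂ (p , q)} {inj₂ (p′ , q′)} e
  with refl ← suc-injective (suc-injective (cong proj₁ e)) =
  cong (λ q → inj₂ (p , q)) (punchIn-injective (suc p) q q′ (punchIn-injective 1F _ _ (cong proj₂ e)))

module _ {n} k (n≤ : n ≤ suc k + k * k) where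

  admissibleFamily : Fin n → Fin (suc (suc k)) × Fin (suc (suc k))
  admissibleFamily i = decodeAdmissible (Inverse.to Fin↔PairCode (inject≤ i n≤))

  admissibleFamily-admissible : ∀ i → Admissible 0F 1F (admissibleFamily i)
  admissibleFamily-admissible i = decodeAdmissible-admissible (Inverse.to Fin↔PairCode (inject≤ i n≤))

  admissibleFamily-injective : Injective _≡_ _≡_ admissibleFamily
  admissibleFamily-injective =
    inject≤-injective n≤ n≤ _ _ ∘ Injection.injective (↔⇒↣ (Fin↔PairCode {k})) ∘
    decodeAdmissible-injective

pattern spine b  = b , zero
pattern page b i = b , suc i

_⟨$⟩_ : BookAut n → BookV n → BookV n
σ ⟨$⟩ x = Inverse.to (BookAut.perm σ) x

module _ (σ : BookAut n) where

  ⟨$⟩-injective : Injective _≡_ _≡_ (σ ⟨$⟩_)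
  ⟨$⟩-injective = Injection.injective (↔⇒↣ (BookAut.perm σ))

  ⟨$⟩-adj : ∀ {x x′ y} → σ ⟨$⟩ x ≡ x′ → BookAdj n x y → BookAdj n x′ (σ ⟨$⟩ y)
  ⟨$⟩-adj refl = proj₁ (BookAut.preserves σ _ _)

spine-adj : ∀ b → BookAdj n (spine b) (spine (not b))
spine-adj false = refl
spine-adj true  = refl

spine-page-adj : ∀ b (i : Fin n) → BookAdj n (spine b) (page b i)
spine-page-adj false _ = tt
spine-page-adj true  _ = tt

page-neighbours : ∀ {b} {i : Fin n} {y} → BookAdj n (page b i) y → y ≡ page (not b) i ⊎ y ≡ spine b
page-neighbours {b = false} {y = true , _}     refl = inj₁ refl
page-neighbours {b = false} {y = spine false}  _    = inj₂ refl
page-neighbours {b = false} {y = page false _} ()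
page-neighbours {b = true}  {y = false , _}    refl = inj₁ refl
page-neighbours {b = true}  {y = spine true}   _    = inj₂ refl
page-neighbours {b = true}  {y = page true _}  ()

spine-neighbour : ∀ {b y} → BookAdj n (spine b) y → y ≢ spine (not b) → ∃ λ j → y ≡ page b j
spine-neighbour {b = false} {y = true , _}     refl y≢ = contradiction refl y≢
spine-neighbour {b = false} {y = page false j} _    _  = j , refl
spine-neighbour {b = false} {y = spine false}  ()
spine-neighbour {b = true}  {y = false , _}    refl y≢ = contradiction refl y≢
spine-neighbour {b = true}  {y = page true j}  _    _  = j , refl
spine-neighbour {b = true}  {y = spine true}   ()

spine↦spine : (σ : BookAut (suc (suc n))) → ∀ b → ∃ λ b′ → σ ⟨$⟩ spine b ≡ spine b′
spine↦spine σ b with σ ⟨$⟩ spine b in eq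
... | spine b′  = b′ , refl
... | page b′ j = ⊥-elim (no-three-distinct-in-pair
                    (distinct λ ()) (distinct λ ()) (distinct λ ())
                    (image (spine-adj b)) (image (spine-page-adj b 0F)) (image (spine-page-adj b 1F)))
  where
  distinct : ∀ {x y} → x ≢ y → σ ⟨$⟩ x ≢ σ ⟨$⟩ y
  distinct x≢y = x≢y ∘ ⟨$⟩-injective σ

  image : ∀ {y} → BookAdj _ (spine b) y → σ ⟨$⟩ y ≡ page (not b′) j ⊎ σ ⟨$⟩ y ≡ spine b′
  image = page-neighbours ∘ ⟨$⟩-adj σ eq

pages↦pages : (σ : BookAut n) → (∀ b → σ ⟨$⟩ spine b ≡ spine b) →
              ∀ i → ∃ λ j → ∀ b → σ ⟨$⟩ page b i ≡ page b j
pages↦pages σ fixes-spine i = j , σpᵢ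
  where
  avoids-spine : ∀ {x} b → x ≢ spine b → σ ⟨$⟩ x ≢ spine b
  avoids-spine b x≢ e = x≢ (⟨$⟩-injective σ (trans e (sym (fixes-spine b))))

  σvᵢ-is-page : ∃ λ j → σ ⟨$⟩ page false i ≡ page false j
  σvᵢ-is-page = spine-neighbour (⟨$⟩-adj σ (fixes-spine false) (spine-page-adj false i))
                                (avoids-spine true λ ())

  j = proj₁ σvᵢ-is-page

  σpᵢ : ∀ b → σ ⟨$⟩ page b i ≡ page b j
  σpᵢ false = proj₂ σvᵢ-is-page
  σpᵢ true  = [ id , ⊥-elim ∘ avoids-spine false (λ ()) ]′
                (page-neighbours (⟨$⟩-adj σ {y = page true i} (σpᵢ false) refl))

mapPages : (Fin n → Fin n) → BookV n → BookV n
mapPages g = map₂ (lift 1 g)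

mapPages-inverse : {f g : Fin n → Fin n} → (∀ i → f (g i) ≡ i) → ∀ x → mapPages f (mapPages g x) ≡ x
mapPages-inverse fg (spine b)  = refl
mapPages-inverse fg (page b i) = cong (page b) (fg i)

mapPages-adj : (g : Fin n → Fin n) → ∀ x y → BookAdj n x y → BookAdj n (mapPages g x) (mapPages g y)
mapPages-adj g (false , _) (true , _)  = cong (lift 1 g)
mapPages-adj g (true , _)  (false , _) = cong (lift 1 g)
mapPages-adj g (spine false)  (page false _) _ = tt
mapPages-adj g (page false _) (spine false)  _ = tt
mapPages-adj g (spine true)   (page true _)  _ = tt
mapPages-adj g (page true _)  (spine true)   _ = tt
mapPages-adj g (spine false)  (spine false)  ()
mapPages-adj g (page false _) (page false _) ()
mapPages-adj g (spine true)   (spine true)   ()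
mapPages-adj g (page true _)  (page true _)  ()

relabelPages : Permutation′ n → BookAut n
relabelPages π = record
  { perm      = mk↔ₛ′ (mapPages (π ⟨$⟩ʳ_)) (mapPages (π ⟨$⟩ˡ_)) π∘π⁻¹ π⁻¹∘π
  ; preserves = λ x y → mapPages-adj _ x y ,
                        subst₂ (BookAdj _) (π⁻¹∘π x) (π⁻¹∘π y) ∘ mapPages-adj _ _ _
  }
  where
  π∘π⁻¹ = mapPages-inverse (λ _ → inverseʳ π)
  π⁻¹∘π = mapPages-inverse (λ _ → inverseˡ π)

pageColours : Coloring n r → Fin n → Fin r × Fin r
pageColours c i = c (page false i) , c (page true i)

SpinesDistinct : Coloring n r → Set
SpinesDistinct c = c (spine false) ≢ c (spine true)

PagesAdmissible : Coloring n r → Set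
PagesAdmissible {n} c = ∀ (i : Fin n) → Admissible (c (spine false)) (c (spine true)) (pageColours c i)

module _ (c : Coloring n r) where

  proper⇒spinesDistinct : Proper n r c → SpinesDistinct c
  proper⇒spinesDistinct proper = proper (spine false) (spine true) refl

  proper⇒pagesAdmissible : Proper n r c → PagesAdmissible c
  proper⇒pagesAdmissible proper i =
    proper (page false i) (spine false) tt , proper (page true i) (spine true) tt ,
    proper (page false i) (page true i) refl

  spinesDistinct∧pagesAdmissible⇒proper : SpinesDistinct c → PagesAdmissible c → Proper n r c
  spinesDistinct∧pagesAdmissible⇒proper spines≢ adm = proper
    where
    rung : ∀ i → c (false , i) ≢ c (true , i)
    rung zero    = spines≢
    rung (suc i) = proj₂ (proj₂ (adm i))

    proper : Proper n r c
    proper (false , i) (true , _)  refl = rung i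
    proper (true , i)  (false , _) refl = rung i ∘ sym
    proper (spine false)  (page false i) _ = proj₁ (adm i) ∘ sym
    proper (page false i) (spine false)  _ = proj₁ (adm i)
    proper (spine true)   (page true i)  _ = proj₁ (proj₂ (adm i)) ∘ sym
    proper (page true i)  (spine true)   _ = proj₁ (proj₂ (adm i))
    proper (spine false)  (spine false)  ()
    proper (page false _) (page false _) ()
    proper (spine true)   (spine true)   ()
    proper (page true _)  (page true _)  ()

  distinguishing⇒pageColours-injective : Distinguishing n r c → Injective _≡_ _≡_ (pageColours c)
  distinguishing⇒pageColours-injective distinguishing {i} {j} same =
    trans (sym (suc-injective (cong proj₂ (distinguishing τ τ-preserves (page false i)))))
          (transpose-moves i j)
    where
    τ = relabelPages (transpose i j)

    τ-preserves : ∀ x → c (τ ⟨$⟩ x) ≡ c x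
    τ-preserves (spine b)      = refl
    τ-preserves (page false l) = cong proj₁ (transpose-invariant (pageColours c) same l)
    τ-preserves (page true l)  = cong proj₂ (transpose-invariant (pageColours c) same l)

pageColours-injective⇒distinguishing : (c : Coloring (suc (suc n)) r) → SpinesDistinct c →
                                       Injective _≡_ _≡_ (pageColours c) → Distinguishing _ r c
pageColours-injective⇒distinguishing c spines≢ pageColours-injective σ preserves = fixed
  where
  spine-colour-injective : ∀ {b b′} → c (spine b) ≡ c (spine b′) → b ≡ b′
  spine-colour-injective {false} {false} _ = refl
  spine-colour-injective {false} {true}  e = contradiction e spines≢
  spine-colour-injective {true}  {false} e = contradiction (sym e) spines≢
  spine-colour-injective {true}  {true}  _ = refl

  recoloured : ∀ {x y} → σ ⟨$⟩ x ≡ y → c y ≡ c x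
  recoloured e = trans (cong c (sym e)) (preserves _)

  fixes-spine : ∀ b → σ ⟨$⟩ spine b ≡ spine b
  fixes-spine b = let b′ , σb = spine↦spine σ b in
    trans σb (cong spine (spine-colour-injective (recoloured σb)))

  fixed : ∀ x → σ ⟨$⟩ x ≡ x
  fixed (spine b)  = fixes-spine b
  fixed (page b i) = let j , σpᵢ = pages↦pages σ fixes-spine i in
    trans (σpᵢ b) (cong (page b) (pageColours-injective
                                    (cong₂ _,_ (recoloured (σpᵢ false)) (recoloured (σpᵢ true)))))

properDistinguishing⇒≤ : (c : Coloring n (suc (suc k))) → Proper n _ c → Distinguishing n _ c →
                         n ≤ suc k + k * k
properDistinguishing⇒≤ c proper distinguishing =
  injective-admissible⇒≤ (proper⇒spinesDistinct c proper) (pageColours c)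
    (proper⇒pagesAdmissible c proper) (distinguishing⇒pageColours-injective c distinguishing)

hasDistCol⇒≤ : ∀ m → HasDistCol n r → r ≤ 2 + m → n ≤ suc m + m * m
hasDistCol⇒≤ {r = 0} m (c , _) _ = ⊥-elim (¬Fin0 (c (spine false)))
hasDistCol⇒≤ {r = 1} m (c , proper , _) _
  with c (spine false) | c (spine true) | proper⇒spinesDistinct c proper
... | zero | zero | 0≢0 = contradiction refl 0≢0
hasDistCol⇒≤ {r = suc (suc k)} m (c , proper , distinguishing) (s≤s (s≤s k≤m)) =
  ≤-trans (properDistinguishing⇒≤ c proper distinguishing) (+-mono-≤ (s≤s k≤m) (*-mono-≤ k≤m k≤m))

spinePageColouring : Fin r → Fin r → (Fin n → Fin r × Fin r) → Coloring n r
spinePageColouring a b f (spine false)  = a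
spinePageColouring a b f (spine true)   = b
spinePageColouring a b f (page false i) = proj₁ (f i)
spinePageColouring a b f (page true i)  = proj₂ (f i)

≤⇒hasDistCol : suc (suc n) ≤ suc k + k * k → HasDistCol (suc (suc n)) (suc (suc k))
≤⇒hasDistCol {k = k} n≤ =
  c , spinesDistinct∧pagesAdmissible⇒proper c (λ ()) (admissibleFamily-admissible k n≤) ,
  pageColours-injective⇒distinguishing c (λ ()) (admissibleFamily-injective k n≤)
  where
  c = spinePageColouring 0F 1F (admissibleFamily k n≤)

pairCount : ∀ m → suc m + m * m ≡ m * m + m + 1
pairCount = solve-∀

lemma5p9 : (n m : ℕ) → 2 ≤ n → 1 ≤ m → CeilSqrtIs n (suc m) →
    (ChiDLess n (suc m + 2) ⇔ (m * m < n × n ≤ m * m + m + 1))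
lemma5p9 (suc (suc n)) m (s≤s (s≤s _)) _ (m*m<n , _) = mk⇔
  (λ (r , r<m+3 , col) →
     m*m<n , ≤-trans (hasDistCol⇒≤ m col (≤-trans (≤-pred r<m+3) (≤-reflexive (+-comm m 2))))
                     (≤-reflexive (pairCount m)))
  (λ (_ , n≤) →
     2 + m , s≤s (≤-reflexive (+-comm 2 m)) ,
     ≤⇒hasDistCol (≤-trans n≤ (≤-reflexive (sym (pairCount m)))))
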